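{- Let $\Gamma\cup\{\alpha,\beta,\varphi,\psi\}\subseteq Fm$. If $\Gamma,\square\alpha\vdash\varphi$ and $\Gamma,\square\beta\vdash\psi$, then $\Gamma,\square\alpha\vee\square\beta\vdash\varphi\vee\psi$, where $\vdash$ denotes derivability in $\mathrm{S5}(\mathcal L)_\infty$.
   Context: Let $Fm$ be the set of formulas over a countably infinite set of variables with $\wedge,\vee,*,\rightarrow,\bar0$ and unary $\square,\lozenge$; $\alpha\equiv\beta:=(\alpha\rightarrow\beta)\wedge(\beta\rightarrow\alpha)$, $\psi^n$ the $n$-fold $*$-power. $\mathrm{S5}(\mathcal L)$ is the calculus with the following axioms: - all instances of the axiom schemata of Łukasiewicz propositional logic; - $\square\varphi\rightarrow\varphi$; - $\varphi\rightarrow\lozenge\varphi$; - $\square(\nu\rightarrow\varphi)\rightarrow(\nu\rightarrow\square\varphi)$; - $\square(\varphi\rightarrow\nu)\rightarrow(\lozenge\varphi\rightarrow\nu)$; - $\square(\varphi\vee\nu)\rightarrow(\square\varphi\vee\nu)$; - $\lozenge(\varphi*\varphi)\equiv(\lozenge\varphi)*(\lozenge\varphi)$. Here $\nu$ is any propositional combination of formulas beginning with $\square$ or $\lozenge$. Its rules are Modus Ponens and Necessitation (from $\varphi$ infer $\square\varphi$). $\mathrm{S5}(\mathcal L)_\infty$ adds the rule $\square$Inf: from $\square\varphi\vee(\square\alpha\rightarrow(\square\beta)^n)$ for every $n\in\mathbb N$, infer $\square\varphi\vee(\square\alpha\rightarrow\square\alpha*\square\beta)$. $\Gamma\vdash\varphi$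 means there is a (possibly transfinite) well-ordered derivation of $\varphi$ in which each member is an axiom instance, a member of $\Gamma$, or the conclusion of a rule instance (Necessitation included) whose premises occur earlier. -}

module Defs where

open import Data.Nat using (ℕ; zero; suc)
open import Data.Sum using (_⊎_)
open import Relation.Binary.PropositionalEquality using (_≡_)

infixr 6 _⇒_
infixr 7 _∨_
infixr 8 _∧_
infixr 9 _*_

data Fm : Set where
  var  : ℕ → Fm
  _∧_  : Fm → Fm → Fm
  _∨_  : Fm → Fm → Fm
  _*_  : Fm → Fm → Fm
  _⇒_  : Fm → Fm → Fm
  𝟘    : Fm
  □    : Fm → Fm
  ◇    : Fm → Fm

¬_ : Fm → Fm
¬ φ = φ ⇒ 𝟘

_⇔_ : Fm → Fm → Fm
α ⇔ β = (α ⇒ β) ∧ (β ⇒ α)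

-- n-fold *-power; ψ ^ 0 is the unit 𝟙 := ¬ 𝟘
_^_ : Fm → ℕ → Fm
ψ ^ zero  = ¬ 𝟘
ψ ^ suc n = ψ * (ψ ^ n)

data Modal : Fm → Set where
  m□ : ∀ φ → Modal (□ φ)
  m◇ : ∀ φ → Modal (◇ φ)
  m𝟘 : Modal 𝟘
  m∧ : ∀ {a b} → Modal a → Modal b → Modal (a ∧ b)
  m∨ : ∀ {a b} → Modal a → Modal b → Modal (a ∨ b)
  m* : ∀ {a b} → Modal a → Modal b → Modal (a * b)
  m⇒ : ∀ {a b} → Modal a → Modal b → Modal (a ⇒ b)

-- Axiom schemata of Łukasiewicz logic (BL/MTL-style axiomatization with
-- primitive ∧, ∨, plus involutive negation), followed by the modal axioms.
data Axiom : Fm → Set where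
  a1  : ∀ φ ψ χ → Axiom ((φ ⇒ ψ) ⇒ ((ψ ⇒ χ) ⇒ (φ ⇒ χ)))
  a2  : ∀ φ ψ → Axiom ((φ * ψ) ⇒ φ)
  a3  : ∀ φ ψ → Axiom ((φ * ψ) ⇒ (ψ * φ))
  a4  : ∀ φ ψ → Axiom ((φ ∧ ψ) ⇒ φ)
  a5  : ∀ φ ψ → Axiom ((φ ∧ ψ) ⇒ (ψ ∧ φ))
  a6  : ∀ φ ψ → Axiom ((φ * (φ ⇒ ψ)) ⇒ (φ ∧ ψ))
  a6' : ∀ φ ψ → Axiom ((φ ∧ ψ) ⇒ (φ * (φ ⇒ ψ)))
  a7a : ∀ φ ψ χ → Axiom ((φ ⇒ (ψ ⇒ χ)) ⇒ ((φ * ψ) ⇒ χ))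
  a7b : ∀ φ ψ χ → Axiom (((φ * ψ) ⇒ χ) ⇒ (φ ⇒ (ψ ⇒ χ)))
  a8  : ∀ φ ψ χ → Axiom (((φ ⇒ ψ) ⇒ χ) ⇒ (((ψ ⇒ φ) ⇒ χ) ⇒ χ))
  a9  : ∀ φ → Axiom (𝟘 ⇒ φ)
  a∨1 : ∀ φ ψ → Axiom (φ ⇒ (φ ∨ ψ))
  a∨2 : ∀ φ ψ → Axiom (ψ ⇒ (φ ∨ ψ))
  a∨3 : ∀ φ ψ χ → Axiom ((φ ⇒ χ) ⇒ ((ψ ⇒ χ) ⇒ ((φ ∨ ψ) ⇒ χ)))
  aŁ  : ∀ φ → Axiom ((¬ ¬ φ) ⇒ φ)
  aT  : ∀ φ → Axiom (□ φ ⇒ φ)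
  aD  : ∀ φ → Axiom (φ ⇒ ◇ φ)
  aK□ : ∀ ν φ → Modal ν → Axiom (□ (ν ⇒ φ) ⇒ (ν ⇒ □ φ))
  aK◇ : ∀ φ ν → Modal ν → Axiom (□ (φ ⇒ ν) ⇒ (◇ φ ⇒ ν))
  aB∨ : ∀ φ ν → Modal ν → Axiom (□ (φ ∨ ν) ⇒ (□ φ ∨ ν))
  a◇* : ∀ φ → Axiom (◇ (φ * φ) ⇔ (◇ φ * ◇ φ))

_,_ : (Fm → Set) → Fm → (Fm → Set)
(Γ , φ) ψ = Γ ψ ⊎ ψ ≡ φ

infix 4 _⊢_
infixl 5 _,_

-- Derivability in S5(Ł)∞ from Γ: the least set containing axioms and Γ and
-- closed under MP, Necessitation and □Inf (equivalently: existence of a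
-- transfinite well-ordered derivation).
data _⊢_ (Γ : Fm → Set) : Fm → Set where
  ax    : ∀ {φ} → Axiom φ → Γ ⊢ φ
  hyp   : ∀ {φ} → Γ φ → Γ ⊢ φ
  mp    : ∀ {φ ψ} → Γ ⊢ φ → Γ ⊢ (φ ⇒ ψ) → Γ ⊢ ψ
  nec   : ∀ {φ} → Γ ⊢ φ → Γ ⊢ □ φ
  □inf  : ∀ {φ α β} → ((n : ℕ) → Γ ⊢ (□ φ ∨ (□ α ⇒ (□ β) ^ n)))
        → Γ ⊢ (□ φ ∨ (□ α ⇒ (□ α * □ β)))

{-# OPTIONS --safe #-}
module Submission where

-- A derivation from Γ , □ β can be replayed with every formula χ replaced by
-- χ ∨ ν, provided ν is modal and □ β ∨ ν is derivable: modus ponens survives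
-- by reasoning inside the disjunction, and Necessitation and □Inf survive
-- because □ (χ ∨ ν) and □ χ ∨ ν are interderivable for modal ν.  Doing this
-- with ν = □ β for the derivation of φ gives φ ∨ □ β, hence □ φ ∨ □ β; doing
-- it again with ν = □ φ for the derivation of ψ gives ψ ∨ □ φ, and □ φ → φ
-- turns this into φ ∨ ψ.

open import Defs
open import Data.Sum using (inj₁; inj₂; map₁)
open import Relation.Binary.PropositionalEquality using (refl)
open import Relation.Unary using (_⊆_)

⊢-mono : ∀ {Γ Δ} → Γ ⊆ Δ → ∀ {φ} → Γ ⊢ φ → Δ ⊢ φ
⊢-mono Γ⊆Δ (ax a)    = ax a
⊢-mono Γ⊆Δ (hyp h)   = hyp (Γ⊆Δ h)
⊢-mono Γ⊆Δ (mp d e)  = mp (⊢-mono Γ⊆Δ d) (⊢-mono Γ⊆Δ e)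
⊢-mono Γ⊆Δ (nec d)   = nec (⊢-mono Γ⊆Δ d)
⊢-mono Γ⊆Δ (□inf ds) = □inf (λ n → ⊢-mono Γ⊆Δ (ds n))

,-mono : ∀ {Γ Δ} γ → Γ ⊆ Δ → (Γ , γ) ⊆ (Δ , γ)
,-mono γ Γ⊆Δ = map₁ Γ⊆Δ

module _ {Δ : Fm → Set} where

  ⇒-trans : ∀ {a b c} → Δ ⊢ a ⇒ b → Δ ⊢ b ⇒ c → Δ ⊢ a ⇒ c
  ⇒-trans {a} {b} {c} a⇒b b⇒c = mp b⇒c (mp a⇒b (ax (a1 a b c)))

  ⇒-swap : ∀ {a b c} → Δ ⊢ a ⇒ (b ⇒ c) → Δ ⊢ b ⇒ (a ⇒ c)
  ⇒-swap {a} {b} {c} d =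
    mp (⇒-trans (ax (a3 b a)) (mp d (ax (a7a a b c)))) (ax (a7b b a c))

  ⇒-const : ∀ {a b} → Δ ⊢ a ⇒ (b ⇒ a)
  ⇒-const {a} {b} = mp (ax (a2 a b)) (ax (a7b a b a))

  ⇒-monoʳ : ∀ {a b c} → Δ ⊢ b ⇒ c → Δ ⊢ (a ⇒ b) ⇒ (a ⇒ c)
  ⇒-monoʳ {a} {b} {c} b⇒c = mp b⇒c (⇒-swap (ax (a1 a b c)))

  ∨-injˡ : ∀ {a b} → Δ ⊢ a → Δ ⊢ a ∨ b
  ∨-injˡ {a} {b} d = mp d (ax (a∨1 a b))

  ∨-elim : ∀ {a b c} → Δ ⊢ a ⇒ c → Δ ⊢ b ⇒ c → Δ ⊢ (a ∨ b) ⇒ c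
  ∨-elim {a} {b} {c} a⇒c b⇒c = mp b⇒c (mp a⇒c (ax (a∨3 a b c)))

  ∨-comm : ∀ {a b} → Δ ⊢ a ∨ b → Δ ⊢ b ∨ a
  ∨-comm {a} {b} d = mp d (∨-elim (ax (a∨2 b a)) (ax (a∨1 b a)))

  ∨-mapˡ : ∀ {a b p} → Δ ⊢ a ⇒ b → Δ ⊢ (a ∨ p) ⇒ (b ∨ p)
  ∨-mapˡ {a} {b} {p} a⇒b = ∨-elim (⇒-trans a⇒b (ax (a∨1 b p))) (ax (a∨2 b p))

  ∨-rotate : ∀ {a p n} → Δ ⊢ ((a ∨ p) ∨ n) ⇒ ((a ∨ n) ∨ p)
  ∨-rotate {a} {p} {n} =
    ∨-elim (∨-mapˡ (ax (a∨1 a n)))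
           (⇒-trans (ax (a∨2 a n)) (ax (a∨1 (a ∨ n) p)))

  mp-∨ : ∀ {χ θ ν} → Δ ⊢ χ ∨ ν → Δ ⊢ (χ ⇒ θ) ∨ ν → Δ ⊢ θ ∨ ν
  mp-∨ {χ} {θ} {ν} χ∨ν χ⇒θ∨ν = mp χ⇒θ∨ν (mp χ∨ν (∨-elim fromχ fromν))
    where
      fromν : ∀ {x} → Δ ⊢ ν ⇒ (x ⇒ (θ ∨ ν))
      fromν = ⇒-trans (ax (a∨2 θ ν)) ⇒-const
      fromχ : Δ ⊢ χ ⇒ (((χ ⇒ θ) ∨ ν) ⇒ (θ ∨ ν))
      fromχ = ⇒-swap (∨-elim (⇒-monoʳ (ax (a∨1 θ ν))) fromν)

  module _ {ν : Fm} (modal : Modal ν) where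

    nec-∨ : ∀ {φ} → Δ ⊢ φ ∨ ν → Δ ⊢ □ φ ∨ ν
    nec-∨ {φ} d = mp (nec d) (ax (aB∨ φ ν modal))

    □-∨-collect : ∀ {φ} → Δ ⊢ (□ φ ∨ ν) ⇒ □ (φ ∨ ν)
    □-∨-collect {φ} = ∨-elim fromφ fromν
      where
        fromφ : Δ ⊢ □ φ ⇒ □ (φ ∨ ν)
        fromφ = mp (nec (⇒-trans (ax (aT φ)) (ax (a∨1 φ ν))))
                   (ax (aK□ (□ φ) (φ ∨ ν) (m□ φ)))
        fromν : Δ ⊢ ν ⇒ □ (φ ∨ ν)
        fromν = mp (nec (ax (a∨2 φ ν))) (ax (aK□ ν (φ ∨ ν) modal))

    discharge : ∀ {β} → Δ ⊢ □ β ∨ ν → ∀ {χ} → (Δ , □ β) ⊢ χ → Δ ⊢ χ ∨ ν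
    discharge □β∨ν (ax a)            = ∨-injˡ (ax a)
    discharge □β∨ν (hyp (inj₁ h))    = ∨-injˡ (hyp h)
    discharge □β∨ν (hyp (inj₂ refl)) = □β∨ν
    discharge □β∨ν (mp d e)          = mp-∨ (discharge □β∨ν d) (discharge □β∨ν e)
    discharge □β∨ν (nec d)           = nec-∨ (discharge □β∨ν d)
    discharge □β∨ν (□inf {φ} {a} {b} ds) =
      mp (□inf premise) (⇒-trans (∨-mapˡ (ax (aB∨ φ ν modal))) ∨-rotate)
      where
        premise : ∀ n → Δ ⊢ □ (φ ∨ ν) ∨ (□ a ⇒ (□ b) ^ n)
        premise n = mp (discharge □β∨ν (ds n)) (⇒-trans ∨-rotate (∨-mapˡ □-∨-collect))

mainTheorem18 : (Γ : Fm → Set) (α β φ ψ : Fm)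
    → (Γ , □ α) ⊢ φ → (Γ , □ β) ⊢ ψ → (Γ , (□ α ∨ □ β)) ⊢ (φ ∨ ψ)
mainTheorem18 Γ α β φ ψ ⊢φ ⊢ψ = mp (∨-comm ψ∨□φ) (∨-mapˡ (ax (aT φ)))
  where
    weaken : ∀ {γ χ} → (Γ , γ) ⊢ χ → (Γ , (□ α ∨ □ β) , γ) ⊢ χ
    weaken {γ} = ⊢-mono (,-mono {Γ} {Γ , (□ α ∨ □ β)} γ inj₁)
    φ∨□β : (Γ , (□ α ∨ □ β)) ⊢ φ ∨ □ β
    φ∨□β = discharge (m□ β) (hyp (inj₂ refl)) (weaken ⊢φ)
    ψ∨□φ : (Γ , (□ α ∨ □ β)) ⊢ ψ ∨ □ φ
    ψ∨□φ = discharge (m□ φ) (∨-comm (nec-∨ (m□ β) φ∨□β)) (weaken ⊢ψ)
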